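{- There exists a set $E\subseteq\mathbb{N}$ which is a $\Delta_{\ell,0}$ set for every $\ell\in\mathbb{N}$ but is not a $\Delta_\ell$ set for any $\ell\in\mathbb{N}$.
   Context: $\mathbb{N}=\{1,2,\dots\}$. Define $\partial:\bigcup_{\ell\ge1}\mathbb{Z}^{2^\ell}\to\mathbb{Z}$ recursively by $\partial(m_1,m_2)=m_2-m_1$ and $\partial(m_1,\dots,m_{2^\ell})=\partial(m_{2^{\ell-1}+1},\dots,m_{2^\ell})-\partial(m_1,\dots,m_{2^{\ell-1}})$ for $\ell>1$. For a finite or infinite sequence $(n_k)$ in $\mathbb{Z}$, $D_\ell((n_k))=\{\partial(n_{j_1},\dots,n_{j_{2^\ell}}):j_1<\dots<j_{2^\ell}\}$. For $r\ge2^\ell$, $E\subseteq\mathbb{N}$ is a $\Delta_{\ell,r}$ set if $D_\ell((n_k)_{k=1}^r)\subseteq E$ for some $r$-element sequence $(n_k)_{k=1}^r$ in $\mathbb{Z}$; $E$ is a $\Delta_{\ell,0}$ set if it contains a $\Delta_{\ell,r}$ set for every $r\ge 2^\ell$. $E$ is a $\Delta_\ell$ set if $D_\ell((n_k)_{k\in\mathbb{N}})\subseteq E$ for some increasing sequence $(n_k)_{k\in\mathbb{N}}$ in $\mathbb{N}$. -}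

module Defs where

open import Data.Nat using (ℕ; zero; suc; _^_; _+_; _≤_; _<_)
open import Data.Integer using (ℤ; +_; _-_)
open import Data.Fin using (Fin; splitAt; _↑ˡ_; _↑ʳ_)
import Data.Fin as F
open import Data.Product using (Σ; ∃; _×_; _,_)
open import Relation.Binary.PropositionalEquality using (_≡_)

-- Level-indexing: the paper's ℓ ≥ 1 is represented as (suc k), k : ℕ.  Note 2 ^ (suc k) = 2 ^ k + (2 ^ k + 0)
-- definitionally, so a 2^(suc k)-tuple splits into its first and second halves.

∂ : (k : ℕ) → (Fin (2 ^ suc k) → ℤ) → ℤ
∂ zero m = m (F.suc F.zero) - m F.zero
∂ (suc k) m =
  ∂ k (λ i → m (2 ^ suc k ↑ʳ (i ↑ˡ 0)))   -- second half m_{2^{ℓ-1}+1..2^ℓ}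
  - ∂ k (λ i → m (i ↑ˡ (2 ^ suc k + 0)))  -- first half m_{1..2^{ℓ-1}}

StrictMono : {n r : ℕ} → (Fin n → Fin r) → Set
StrictMono {n} j = ∀ (a b : Fin n) → a F.< b → j a F.< j b

-- subsets of ℕ = {1,2,…}: predicates on Agda's ℕ whose members are all ≥ 1
Subset : Set₁
Subset = ℕ → Set

IsSubsetOfPositives : Subset → Set
IsSubsetOfPositives E = ∀ n → E n → 1 ≤ n

_∈ℤ_ : ℤ → Subset → Set
z ∈ℤ E = Σ ℕ λ n → (z ≡ + n) × E n

DSubsetFin : (k : ℕ) {r : ℕ} → (Fin r → ℤ) → Subset → Set
DSubsetFin k {r} seq E =
  ∀ (j : Fin (2 ^ suc k) → Fin r) → StrictMono j → ∂ k (λ i → seq (j i)) ∈ℤ E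

-- E is a Δ_{ℓ,r} set (ℓ = suc k, r ≥ 2^ℓ assumed by the caller)
IsΔfin : (k r : ℕ) → Subset → Set
IsΔfin k r E = Σ (Fin r → ℤ) λ seq → DSubsetFin k seq E

-- E is a Δ_{ℓ,0} set: contains a Δ_{ℓ,r} set for every r ≥ 2^ℓ
-- (containing a Δ_{ℓ,r} set is equivalent to being one, since the notion is upward closed;
--  we state it as: for each r ≥ 2^ℓ there is F ⊆ E which is Δ_{ℓ,r})
IsΔ0 : (k : ℕ) → Subset → Set₁
IsΔ0 k E = ∀ r → 2 ^ suc k ≤ r →
  Σ Subset λ F' → (∀ n → F' n → E n) × IsΔfin k r F'

IsΔ : (k : ℕ) → Subset → Set
IsΔ k E = Σ (ℕ → ℕ) λ seq →
  (∀ i → 1 ≤ seq i) × (∀ i → seq i < seq (suc i)) ×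
  (∀ (j : Fin (2 ^ suc k) → ℕ) → (∀ (a b : Fin (2 ^ suc k)) → a F.< b → j a < j b) →
     ∂ k (λ i → + seq (j i)) ∈ℤ E)

-- E is the union of the dyadic blocks 2^a · {1, …, 2^a}.
--
-- If every entry of a tuple is at least twice the previous one, its ∂ lies between the first
-- entry and the last entry minus the first.  Hence for the r terms 2^r · 2^i (i < r) every
-- element of D_ℓ is 2^r · v with 1 ≤ v ≤ 2^r, i.e. lies in E, for every ℓ.
--
-- Conversely D_ℓ of an infinite increasing sequence contains pairs x, x + c with c fixed and x
-- arbitrarily large.  Two elements of E at distance c are at most c², since the smaller of their
-- dyadic scales 2^a divides c; so E is not a Δ_ℓ set.

module Submission where

open import Defs
open import Data.Nat as ℕ using (ℕ; zero; suc; _^_; _≤_; _<_; z≤n; s≤s; _∸_)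
import Data.Nat.Properties as ℕₚ
open import Data.Nat.Divisibility using (_∣_; divides; ∣m+n∣m⇒∣n; ∣⇒≤; ∣-trans; m∣m*n)
open import Data.Integer as ℤ using (ℤ; +_; _-_; +≤+; 0ℤ)
import Data.Integer.Properties as ℤₚ
import Data.Integer.Tactic.RingSolver as ℤ-Solver
open import Data.Fin as F using (Fin; toℕ; _↑ˡ_; _↑ʳ_)
import Data.Fin.Properties as Fₚ
open import Data.Product using (Σ; _×_; _,_; proj₁; proj₂)
open import Data.Sum using (inj₁; inj₂)
open import Data.Empty using (⊥-elim)
open import Function using (_∘_)
open import Relation.Binary.PropositionalEquality
open import Relation.Binary.Definitions using (tri<; tri≈; tri>)
open import Relation.Nullary using (¬_)

left : ∀ k → Fin (2 ^ suc k) → Fin (2 ^ suc (suc k))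
left k i = i ↑ˡ (2 ^ suc k ℕ.+ 0)

right : ∀ k → Fin (2 ^ suc k) → Fin (2 ^ suc (suc k))
right k i = 2 ^ suc k ↑ʳ (i ↑ˡ 0)

toℕ-left : ∀ k (i : Fin (2 ^ suc k)) → toℕ (left k i) ≡ toℕ i
toℕ-left k i = Fₚ.toℕ-↑ˡ i (2 ^ suc k ℕ.+ 0)

toℕ-right : ∀ k (i : Fin (2 ^ suc k)) → toℕ (right k i) ≡ 2 ^ suc k ℕ.+ toℕ i
toℕ-right k i = trans (Fₚ.toℕ-↑ʳ (2 ^ suc k) (i ↑ˡ 0)) (cong (2 ^ suc k ℕ.+_) (Fₚ.toℕ-↑ˡ i 0))

2^suc-double : ∀ k → 2 ^ suc (suc k) ≡ 2 ^ suc k ℕ.+ 2 ^ suc k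
2^suc-double k = cong (2 ^ suc k ℕ.+_) (ℕₚ.+-identityʳ (2 ^ suc k))

2≤2^suc : ∀ k → 2 ≤ 2 ^ suc k
2≤2^suc k = ℕₚ.*-monoʳ-≤ 2 (ℕₚ.m^n>0 2 k)

left-<-right : ∀ k (i j : Fin (2 ^ suc k)) → left k i F.< right k j
left-<-right k i j = subst₂ _<_ (sym (toℕ-left k i)) (sym (toℕ-right k j))
  (ℕₚ.<-≤-trans (Fₚ.toℕ<n i) (ℕₚ.m≤m+n (2 ^ suc k) (toℕ j)))

left-mono-< : ∀ k {i j : Fin (2 ^ suc k)} → i F.< j → left k i F.< left k j
left-mono-< k {i} {j} = subst₂ _<_ (sym (toℕ-left k i)) (sym (toℕ-left k j))

right-mono-≤ : ∀ k {i j : Fin (2 ^ suc k)} → i F.≤ j → right k i F.≤ right k j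
right-mono-≤ k {i} {j} i≤j =
  subst₂ _≤_ (sym (toℕ-right k i)) (sym (toℕ-right k j)) (ℕₚ.+-monoʳ-≤ (2 ^ suc k) i≤j)

right-mono-< : ∀ k {i j : Fin (2 ^ suc k)} → i F.< j → right k i F.< right k j
right-mono-< k {i} {j} i<j =
  subst₂ _<_ (sym (toℕ-right k i)) (sym (toℕ-right k j)) (ℕₚ.+-monoʳ-< (2 ^ suc k) i<j)

∂-cong : ∀ k {m m' : Fin (2 ^ suc k) → ℤ} → (∀ i → m i ≡ m' i) → ∂ k m ≡ ∂ k m'
∂-cong zero    m≗m' = cong₂ _-_ (m≗m' _) (m≗m' _)
∂-cong (suc k) m≗m' = cong₂ _-_ (∂-cong k (m≗m' ∘ right k)) (∂-cong k (m≗m' ∘ left k))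

*-distribˡ-sub : ∀ c a b → c ℤ.* a - c ℤ.* b ≡ c ℤ.* (a - b)
*-distribˡ-sub = ℤ-Solver.solve-∀

∂-* : ∀ k c (m : Fin (2 ^ suc k) → ℤ) → ∂ k (λ i → c ℤ.* m i) ≡ c ℤ.* ∂ k m
∂-* zero    c m = *-distribˡ-sub c _ _
∂-* (suc k) c m =
  trans (cong₂ _-_ (∂-* k c (m ∘ right k)) (∂-* k c (m ∘ left k))) (*-distribˡ-sub c _ _)

sub-interchange : ∀ a b c d → (a - b) - (c - d) ≡ (a - c) - (b - d)
sub-interchange = ℤ-Solver.solve-∀

sub-cancelʳ : ∀ a b c → (a - c) - (b - c) ≡ a - b
sub-cancelʳ = ℤ-Solver.solve-∀

sub-eq⇒+-eq : ∀ {a b c d} → + a - + b ≡ + c - + d → a ℕ.+ d ≡ b ℕ.+ c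
sub-eq⇒+-eq {a} {b} {c} {d} eq = ℤₚ.+-injective (begin
  + (a ℕ.+ d)                   ≡⟨ ℤₚ.pos-+ a d ⟩
  + a ℤ.+ + d                   ≡⟨ split (+ a) (+ b) (+ d) ⟩
  (+ a - + b) ℤ.+ (+ b ℤ.+ + d) ≡⟨ cong (ℤ._+ (+ b ℤ.+ + d)) eq ⟩
  (+ c - + d) ℤ.+ (+ b ℤ.+ + d) ≡⟨ merge (+ b) (+ c) (+ d) ⟩
  + b ℤ.+ + c                   ≡⟨ ℤₚ.pos-+ b c ⟨
  + (b ℕ.+ c)                   ∎)
  where
  open ≡-Reasoning
  split : ∀ a b d → a ℤ.+ d ≡ (a - b) ℤ.+ (b ℤ.+ d)
  split = ℤ-Solver.solve-∀
  merge : ∀ b c d → (c - d) ℤ.+ (b ℤ.+ d) ≡ b ℤ.+ c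
  merge = ℤ-Solver.solve-∀

∂-differ-in-last-two : ∀ k (m m' : Fin (2 ^ suc k) → ℤ) u w →
  (∀ i → 2 ℕ.+ toℕ i < 2 ^ suc k → m i ≡ m' i) →
  (∀ i → 2 ℕ.+ toℕ i ≡ 2 ^ suc k → m i - m' i ≡ u) →
  (∀ i → 1 ℕ.+ toℕ i ≡ 2 ^ suc k → m i - m' i ≡ w) →
  ∂ k m - ∂ k m' ≡ w - u
∂-differ-in-last-two zero m m' u w _ penultimate last =
  trans (sub-interchange (m (F.suc F.zero)) (m F.zero) (m' (F.suc F.zero)) (m' F.zero))
        (cong₂ _-_ (last _ refl) (penultimate _ refl))
∂-differ-in-last-two (suc k) m m' u w agree penultimate last = begin
    (∂ k (m ∘ right k) - ∂ k (m ∘ left k)) - (∂ k (m' ∘ right k) - ∂ k (m' ∘ left k))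
  ≡⟨ cong (λ x → (∂ k (m ∘ right k) - x) - _) (∂-cong k (λ i → agree (left k i) (left-below i))) ⟩
    (∂ k (m ∘ right k) - ∂ k (m' ∘ left k)) - (∂ k (m' ∘ right k) - ∂ k (m' ∘ left k))
  ≡⟨ sub-cancelʳ (∂ k (m ∘ right k)) (∂ k (m' ∘ right k)) (∂ k (m' ∘ left k)) ⟩
    ∂ k (m ∘ right k) - ∂ k (m' ∘ right k)
  ≡⟨ ∂-differ-in-last-two k _ _ u w
       (λ i h → agree (right k i)
         (subst₂ _<_ (sym (right-shift 2 i)) (sym (2^suc-double k)) (ℕₚ.+-monoʳ-< n h)))
       (λ i h → penultimate (right k i) (right-shift-≡ 2 i h))
       (λ i h → last (right k i) (right-shift-≡ 1 i h)) ⟩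
    w - u
  ∎
  where
  open ≡-Reasoning
  n = 2 ^ suc k
  left-below : ∀ i → 2 ℕ.+ toℕ (left k i) < 2 ^ suc (suc k)
  left-below i = subst₂ (λ a b → 2 ℕ.+ a < b) (sym (toℕ-left k i)) (sym (2^suc-double k))
    (ℕₚ.<-≤-trans (ℕₚ.+-monoʳ-< 2 (Fₚ.toℕ<n i)) (ℕₚ.+-monoˡ-≤ n (2≤2^suc k)))
  right-shift : ∀ d i → d ℕ.+ toℕ (right k i) ≡ n ℕ.+ (d ℕ.+ toℕ i)
  right-shift d i = begin
    d ℕ.+ toℕ (right k i)   ≡⟨ cong (d ℕ.+_) (toℕ-right k i) ⟩
    d ℕ.+ (n ℕ.+ toℕ i)     ≡⟨ sym (ℕₚ.+-assoc d n (toℕ i)) ⟩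
    d ℕ.+ n ℕ.+ toℕ i       ≡⟨ cong (ℕ._+ toℕ i) (ℕₚ.+-comm d n) ⟩
    n ℕ.+ d ℕ.+ toℕ i       ≡⟨ ℕₚ.+-assoc n d (toℕ i) ⟩
    n ℕ.+ (d ℕ.+ toℕ i)     ∎
  right-shift-≡ : ∀ d i → d ℕ.+ toℕ i ≡ n → d ℕ.+ toℕ (right k i) ≡ 2 ^ suc (suc k)
  right-shift-≡ d i h = trans (right-shift d i) (trans (cong (n ℕ.+_) h) (sym (2^suc-double k)))

Doubling : ∀ {n} → (Fin n → ℤ) → Set
Doubling m = ∀ a b → a F.< b → m a ℤ.+ m a ℤ.≤ m b

doubling⇒monotone : ∀ {n} {m : Fin n → ℤ} → (∀ a → 0ℤ ℤ.≤ m a) → Doubling m →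
  ∀ {a b} → a F.≤ b → m a ℤ.≤ m b
doubling⇒monotone {m = m} nonneg doubling {a} {b} a≤b with ℕₚ.m≤n⇒m<n∨m≡n a≤b
... | inj₁ a<b = ℤₚ.≤-trans (ℤₚ.i≤i+j (m a) (m a) {{ℤ.nonNegative (nonneg a)}}) (doubling a b a<b)
... | inj₂ a≡b = ℤₚ.≤-reflexive (cong m (Fₚ.toℕ-injective a≡b))

sub-within : ∀ {lo hi x a b} → 0ℤ ℤ.≤ x → x ℤ.≤ a → a ℤ.≤ hi - x → lo ℤ.≤ b → b ℤ.≤ x - lo →
  lo ℤ.≤ a - b × a - b ℤ.≤ hi - lo
sub-within {lo} {hi} {x} {a} {b} 0≤x x≤a a≤hi-x lo≤b b≤x-lo = lower , upper
  where
  open ℤₚ.≤-Reasoning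
  lower : lo ℤ.≤ a - b
  lower = begin
    lo             ≡⟨ sub-sub-cancel x lo ⟨
    x - (x - lo)   ≤⟨ ℤₚ.+-mono-≤ x≤a (ℤₚ.neg-mono-≤ b≤x-lo) ⟩
    a - b          ∎
    where
    sub-sub-cancel : ∀ x y → x - (x - y) ≡ y
    sub-sub-cancel = ℤ-Solver.solve-∀
  upper : a - b ℤ.≤ hi - lo
  upper = begin
    a - b          ≤⟨ ℤₚ.+-mono-≤ a≤hi-x (ℤₚ.neg-mono-≤ lo≤b) ⟩
    (hi - x) - lo  ≡⟨ sub-swap hi x lo ⟩
    (hi - lo) - x  ≤⟨ ℤₚ.i-j≤i (hi - lo) x {{ℤ.nonNegative 0≤x}} ⟩
    hi - lo        ∎
    where
    sub-swap : ∀ x y z → (x - y) - z ≡ (x - z) - y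
    sub-swap = ℤ-Solver.solve-∀

∂-doubling-bounds : ∀ k (m : Fin (2 ^ suc k) → ℤ) {lo hi} → 0ℤ ℤ.≤ lo →
  (∀ a → lo ℤ.≤ m a) → (∀ a → m a ℤ.≤ hi) → Doubling m →
  lo ℤ.≤ ∂ k m × ∂ k m ℤ.≤ hi - lo
∂-doubling-bounds zero m {lo} 0≤lo lo≤m m≤hi doubling = lower , upper
  where
  open ℤₚ.≤-Reasoning
  m₀ = m F.zero
  m₁ = m (F.suc F.zero)
  lower : lo ℤ.≤ m₁ - m₀
  lower = begin
    lo                ≡⟨ add-sub-cancel lo m₀ ⟨
    (lo ℤ.+ m₀) - m₀  ≤⟨ ℤₚ.+-monoˡ-≤ (ℤ.- m₀) (ℤₚ.+-monoˡ-≤ m₀ (lo≤m F.zero)) ⟩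
    (m₀ ℤ.+ m₀) - m₀  ≤⟨ ℤₚ.+-monoˡ-≤ (ℤ.- m₀) (doubling F.zero (F.suc F.zero) (s≤s z≤n)) ⟩
    m₁ - m₀           ∎
    where
    add-sub-cancel : ∀ x y → (x ℤ.+ y) - y ≡ x
    add-sub-cancel = ℤ-Solver.solve-∀
  upper = ℤₚ.+-mono-≤ (m≤hi _) (ℤₚ.neg-mono-≤ (lo≤m F.zero))
∂-doubling-bounds (suc k) m {hi = hi} 0≤lo lo≤m m≤hi doubling =
  sub-within {hi = hi} 0≤X (proj₁ right-bounds) (proj₂ right-bounds)
    (proj₁ left-bounds) (proj₂ left-bounds)
  where
  first : Fin (2 ^ suc k)
  first = F.fromℕ< (ℕₚ.m^n>0 2 (suc k))
  first-≤ : ∀ a → first F.≤ a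
  first-≤ a = subst (_≤ toℕ a) (sym (Fₚ.toℕ-fromℕ< (ℕₚ.m^n>0 2 (suc k)))) z≤n
  X = m (right k first)
  0≤X = ℤₚ.≤-trans 0≤lo (lo≤m _)
  monotone = doubling⇒monotone (λ a → ℤₚ.≤-trans 0≤lo (lo≤m a)) doubling
  left-bounds = ∂-doubling-bounds k (m ∘ left k) 0≤lo (lo≤m ∘ left k)
    (λ a → monotone (ℕₚ.<⇒≤ (left-<-right k a first)))
    (λ a b → doubling _ _ ∘ left-mono-< k)
  right-bounds = ∂-doubling-bounds k (m ∘ right k) 0≤X
    (λ a → monotone (right-mono-≤ k (first-≤ a))) (m≤hi ∘ right k)
    (λ a b → doubling _ _ ∘ right-mono-< k)

ℤ-between : ∀ {z b} → + 1 ℤ.≤ z → z ℤ.≤ + b → Σ ℕ λ v → z ≡ + v × 1 ≤ v × v ≤ b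
ℤ-between {+ v} (+≤+ 1≤v) (+≤+ v≤b) = v , refl , 1≤v , v≤b

2^-doubling : ∀ {a b} → a < b → 2 ^ a ℕ.+ 2 ^ a ≤ 2 ^ b
2^-doubling {a} {b} a<b =
  subst (_≤ 2 ^ b) (cong (2 ^ a ℕ.+_) (ℕₚ.+-identityʳ (2 ^ a))) (ℕₚ.^-monoʳ-≤ 2 a<b)

∂-powers-of-two : ∀ k {r} (j : Fin (2 ^ suc k) → Fin r) → StrictMono j →
  Σ ℕ λ v → ∂ k (λ i → + (2 ^ toℕ (j i))) ≡ + v × 1 ≤ v × v ≤ 2 ^ r
∂-powers-of-two k {r} j j-mono =
  ℤ-between (proj₁ bounds) (ℤₚ.≤-trans (proj₂ bounds) (ℤₚ.i-j≤i (+ (2 ^ r)) (+ 1)))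
  where
  bounds = ∂-doubling-bounds k (λ i → + (2 ^ toℕ (j i))) (+≤+ z≤n)
    (λ a → +≤+ (ℕₚ.m^n>0 2 (toℕ (j a))))
    (λ a → +≤+ (ℕₚ.^-monoʳ-≤ 2 (ℕₚ.<⇒≤ (Fₚ.toℕ<n (j a)))))
    (λ a b a<b → +≤+ (2^-doubling (j-mono a b a<b)))

E : Subset
E x = Σ ℕ λ a → Σ ℕ λ v → x ≡ 2 ^ a ℕ.* v × 1 ≤ v × v ≤ 2 ^ a

E-positive : IsSubsetOfPositives E
E-positive _ (a , v , refl , 1≤v , _) = ℕₚ.*-mono-≤ (ℕₚ.m^n>0 2 a) 1≤v

E-isΔ0 : ∀ k → IsΔ0 k E
E-isΔ0 k r _ = E , (λ _ x∈E → x∈E) , scaled-powers , ∂-scaled-powers∈E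
  where
  scaled-powers : Fin r → ℤ
  scaled-powers i = + (2 ^ r ℕ.* 2 ^ toℕ i)
  ∂-scaled-powers∈E : DSubsetFin k scaled-powers E
  ∂-scaled-powers∈E j j-mono with ∂-powers-of-two k j j-mono
  ... | v , ∂≡v , 1≤v , v≤2^r = 2 ^ r ℕ.* v , ∂≡2^r*v , r , v , refl , 1≤v , v≤2^r
    where
    open ≡-Reasoning
    ∂≡2^r*v : ∂ k (scaled-powers ∘ j) ≡ + (2 ^ r ℕ.* v)
    ∂≡2^r*v = begin
      ∂ k (scaled-powers ∘ j)                         ≡⟨ ∂-cong k (λ i → ℤₚ.pos-* (2 ^ r) (2 ^ toℕ (j i))) ⟩
      ∂ k (λ i → + (2 ^ r) ℤ.* + (2 ^ toℕ (j i)))     ≡⟨ ∂-* k (+ (2 ^ r)) _ ⟩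
      + (2 ^ r) ℤ.* ∂ k (λ i → + (2 ^ toℕ (j i)))     ≡⟨ cong (+ (2 ^ r) ℤ.*_) ∂≡v ⟩
      + (2 ^ r) ℤ.* + v                               ≡⟨ ℤₚ.pos-* (2 ^ r) v ⟨
      + (2 ^ r ℕ.* v)                                 ∎

^-monoʳ-∣ : ∀ m {a b} → a ≤ b → m ^ a ∣ m ^ b
^-monoʳ-∣ m {a} {b} a≤b = divides (m ^ (b ∸ a)) (begin
  m ^ b                  ≡⟨ cong (m ^_) (ℕₚ.m∸n+n≡m a≤b) ⟨
  m ^ (b ∸ a ℕ.+ a)      ≡⟨ ℕₚ.^-distribˡ-+-* m (b ∸ a) a ⟩
  m ^ (b ∸ a) ℕ.* m ^ a  ∎)
  where open ≡-Reasoning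

∣-gap : ∀ {d x c} → 1 ≤ c → d ∣ x → d ∣ x ℕ.+ c → d ≤ c
∣-gap 1≤c d∣x d∣x+c = ∣⇒≤ {{ℕ.>-nonZero 1≤c}} (∣m+n∣m⇒∣n d∣x+c d∣x)

E-element : ∀ {x} → E x → Σ ℕ λ a → 2 ^ a ∣ x × x ≤ 2 ^ a ℕ.* 2 ^ a
E-element (a , v , refl , _ , v≤2^a) = a , m∣m*n v , ℕₚ.*-monoʳ-≤ (2 ^ a) v≤2^a

E-gap : ∀ {x c} → 1 ≤ c → E x → E (x ℕ.+ c) → x ≤ c ℕ.* c
E-gap {x} {c} 1≤c x∈E x+c∈E with E-element x∈E | E-element x+c∈E
... | a , 2^a∣x , x≤ | b , 2^b∣x+c , x+c≤ with ℕₚ.≤-total a b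
... | inj₁ a≤b = ℕₚ.≤-trans x≤ (ℕₚ.*-mono-≤ 2^a≤c 2^a≤c)
  where
  2^a≤c = ∣-gap 1≤c 2^a∣x (∣-trans (^-monoʳ-∣ 2 a≤b) 2^b∣x+c)
... | inj₂ b≤a = ℕₚ.≤-trans (ℕₚ.m≤m+n x c) (ℕₚ.≤-trans x+c≤ (ℕₚ.*-mono-≤ 2^b≤c 2^b≤c))
  where
  2^b≤c = ∣-gap 1≤c (∣-trans (^-monoʳ-∣ 2 b≤a) 2^a∣x) 2^b∣x+c

select : ℕ → ℕ → ℕ → ℕ → ℕ
select M p t i with ℕₚ.<-cmp i M
... | tri< _ _ _ = i
... | tri≈ _ _ _ = p
... | tri> _ _ _ = t

module _ {M p t : ℕ} where

  select-< : ∀ {i} → i < M → select M p t i ≡ i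
  select-< {i} i<M with ℕₚ.<-cmp i M
  ... | tri< _ _ _    = refl
  ... | tri≈ i≮M _ _  = ⊥-elim (i≮M i<M)
  ... | tri> i≮M _ _  = ⊥-elim (i≮M i<M)

  select-≡ : ∀ {i} → i ≡ M → select M p t i ≡ p
  select-≡ {i} i≡M with ℕₚ.<-cmp i M
  ... | tri< _ i≢M _  = ⊥-elim (i≢M i≡M)
  ... | tri≈ _ _ _    = refl
  ... | tri> _ i≢M _  = ⊥-elim (i≢M i≡M)

  select-> : ∀ {i} → M < i → select M p t i ≡ t
  select-> {i} M<i with ℕₚ.<-cmp i M
  ... | tri< _ _ M≯i  = ⊥-elim (M≯i M<i)
  ... | tri≈ _ _ M≯i  = ⊥-elim (M≯i M<i)
  ... | tri> _ _ _    = refl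

  module _ (M≤p : M ≤ p) (p<t : p < t) where

    <-select : ∀ {a} b → a < M → a < b → a < select M p t b
    <-select b a<M a<b with ℕₚ.<-cmp b M
    ... | tri< _ _ _ = a<b
    ... | tri≈ _ _ _ = ℕₚ.<-≤-trans a<M M≤p
    ... | tri> _ _ _ = ℕₚ.<-trans (ℕₚ.<-≤-trans a<M M≤p) p<t

    select-mono-≤1+ : ∀ {a b} → a < b → b ≤ suc M → select M p t a < select M p t b
    select-mono-≤1+ {a} {b} a<b b≤1+M with ℕₚ.<-cmp a M
    ... | tri< a<M _ _  = <-select b a<M a<b
    ... | tri≈ _ a≡M _  = subst (p <_) (sym (select-> (subst (_< b) a≡M a<b))) p<t
    ... | tri> _ _ M<a  = ⊥-elim (ℕₚ.<⇒≱ M<a (ℕₚ.≤-pred (ℕₚ.<-≤-trans a<b b≤1+M)))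

penultimate : ℕ → ℕ
penultimate k = 2 ^ suc k ∸ 2

choose-last-two : ∀ k → ℕ → ℕ → Fin (2 ^ suc k) → ℕ
choose-last-two k p t i = select (penultimate k) p t (toℕ i)

module _ (k : ℕ) where

  private
    M = penultimate k

    2^suc≡2+M : 2 ^ suc k ≡ 2 ℕ.+ M
    2^suc≡2+M = sym (ℕₚ.m+[n∸m]≡n (2≤2^suc k))

  sample : (ℕ → ℕ) → ℕ → ℕ → Fin (2 ^ suc k) → ℤ
  sample s p t i = + s (choose-last-two k p t i)

  choose-last-two-mono : ∀ {p t} → M ≤ p → p < t →
    ∀ a b → a F.< b → choose-last-two k p t a < choose-last-two k p t b
  choose-last-two-mono M≤p p<t a b a<b = select-mono-≤1+ M≤p p<t a<b
    (ℕₚ.≤-pred (subst (toℕ b <_) 2^suc≡2+M (Fₚ.toℕ<n b)))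

  ∂-sample-differ : ∀ s p t p' t' →
    ∂ k (sample s p t) - ∂ k (sample s p' t') ≡ (+ s t - + s t') - (+ s p - + s p')
  ∂-sample-differ s p t p' t' = ∂-differ-in-last-two k _ _ _ _
    (λ i h → cong (+_ ∘ s) (trans (select-< (below i h)) (sym (select-< (below i h)))))
    (λ i h → cong₂ _-_ (cong (+_ ∘ s) (select-≡ (at i h))) (cong (+_ ∘ s) (select-≡ (at i h))))
    (λ i h → cong₂ _-_ (cong (+_ ∘ s) (select-> (above i h))) (cong (+_ ∘ s) (select-> (above i h))))
    where
    below : ∀ i → 2 ℕ.+ toℕ i < 2 ^ suc k → toℕ i < M
    below i h = ℕₚ.+-cancelˡ-< 2 (toℕ i) M (subst (2 ℕ.+ toℕ i <_) 2^suc≡2+M h)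
    at : ∀ i → 2 ℕ.+ toℕ i ≡ 2 ^ suc k → toℕ i ≡ M
    at i h = ℕₚ.+-cancelˡ-≡ 2 (toℕ i) M (trans h 2^suc≡2+M)
    above : ∀ i → 1 ℕ.+ toℕ i ≡ 2 ^ suc k → M < toℕ i
    above i h = subst (M <_) (sym (ℕₚ.+-cancelˡ-≡ 1 (toℕ i) (suc M) (trans h 2^suc≡2+M))) (ℕₚ.n<1+n M)

  ∂-sample-vary-penultimate : ∀ s {p p' t y x} →
    ∂ k (sample s p t) ≡ + y → ∂ k (sample s p' t) ≡ + x → y ℕ.+ s p ≡ x ℕ.+ s p'
  ∂-sample-vary-penultimate s {p} {p'} {t} {y} {x} ∂≡y ∂≡x = sub-eq⇒+-eq {y} {x} {s p'} {s p} (begin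
    + y - + x                               ≡⟨ cong₂ _-_ ∂≡y ∂≡x ⟨
    ∂ k (sample s p t) - ∂ k (sample s p' t) ≡⟨ ∂-sample-differ s p t p' t ⟩
    (+ s t - + s t) - (+ s p - + s p')      ≡⟨ cancel (+ s t) (+ s p) (+ s p') ⟩
    + s p' - + s p                          ∎)
    where
    open ≡-Reasoning
    cancel : ∀ a b c → (a - a) - (b - c) ≡ c - b
    cancel = ℤ-Solver.solve-∀

  ∂-sample-vary-last : ∀ s {p t t' x x₀} →
    ∂ k (sample s p t) ≡ + x → ∂ k (sample s p t') ≡ + x₀ → x ℕ.+ s t' ≡ x₀ ℕ.+ s t
  ∂-sample-vary-last s {p} {t} {t'} {x} {x₀} ∂≡x ∂≡x₀ = sub-eq⇒+-eq {x} {x₀} {s t} {s t'} (begin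
    + x - + x₀                               ≡⟨ cong₂ _-_ ∂≡x ∂≡x₀ ⟨
    ∂ k (sample s p t) - ∂ k (sample s p t') ≡⟨ ∂-sample-differ s p t p t' ⟩
    (+ s t - + s t') - (+ s p - + s p)       ≡⟨ cancel (+ s t) (+ s t') (+ s p) ⟩
    + s t - + s t'                           ∎)
    where
    open ≡-Reasoning
    cancel : ∀ a b c → (a - b) - (c - c) ≡ a - b
    cancel = ℤ-Solver.solve-∀

strictly-increasing⇒n≤ : ∀ {s : ℕ → ℕ} → (∀ i → s i < s (suc i)) → ∀ i → i ≤ s i
strictly-increasing⇒n≤ s-inc zero    = z≤n
strictly-increasing⇒n≤ s-inc (suc i) = ℕₚ.≤-<-trans (strictly-increasing⇒n≤ s-inc i) (s-inc i)

-- Replacing s_M by s_{M+1} in the penultimate slot shifts ∂ by the fixed amount c, whereas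
-- moving the last slot far out makes ∂ arbitrarily large.
IsΔ⇒translate-pairs : ∀ k {F} → IsΔ k F →
  Σ ℕ λ c → 1 ≤ c × (∀ B → Σ ℕ λ x → B < x × F x × F (x ℕ.+ c))
IsΔ⇒translate-pairs k {F} (s , _ , s-inc , D) = c , ℕₚ.m<n⇒0<n∸m (s-inc M) , pair
  where
  M = penultimate k
  c = s (1 ℕ.+ M) ∸ s M
  ∂-sample∈F : ∀ {p t} → M ≤ p → p < t → ∂ k (sample k s p t) ∈ℤ F
  ∂-sample∈F {p} {t} M≤p p<t = D (choose-last-two k p t) (choose-last-two-mono k M≤p p<t)
  pair : ∀ B → Σ ℕ λ x → B < x × F x × F (x ℕ.+ c)
  pair B = from-samples (∂-sample∈F ℕₚ.≤-refl M<t) (∂-sample∈F (ℕₚ.n≤1+n M) 1+M<t)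
    (∂-sample∈F (ℕₚ.n≤1+n M) (ℕₚ.n<1+n (1 ℕ.+ M)))
    where
    t = suc (s (2 ℕ.+ M) ℕ.+ B)
    2+M<t : 2 ℕ.+ M < t
    2+M<t = s≤s (ℕₚ.≤-trans (strictly-increasing⇒n≤ s-inc (2 ℕ.+ M)) (ℕₚ.m≤m+n _ B))
    1+M<t = ℕₚ.<-trans (ℕₚ.n<1+n (1 ℕ.+ M)) 2+M<t
    M<t = ℕₚ.<-trans (ℕₚ.n<1+n M) 1+M<t
    from-samples : ∂ k (sample k s M t) ∈ℤ F → ∂ k (sample k s (1 ℕ.+ M) t) ∈ℤ F →
      ∂ k (sample k s (1 ℕ.+ M) (2 ℕ.+ M)) ∈ℤ F → Σ ℕ λ x → B < x × F x × F (x ℕ.+ c)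
    from-samples (y , ∂≡y , y∈F) (x , ∂≡x , x∈F) (x₀ , ∂≡x₀ , _) =
      x , B<x , x∈F , subst F y≡x+c y∈F
      where
      y≡x+c : y ≡ x ℕ.+ c
      y≡x+c = ℕₚ.+-cancelʳ-≡ (s M) y (x ℕ.+ c) (begin
        y ℕ.+ s M              ≡⟨ ∂-sample-vary-penultimate k s {M} {1 ℕ.+ M} {t} ∂≡y ∂≡x ⟩
        x ℕ.+ s (1 ℕ.+ M)      ≡⟨ cong (x ℕ.+_) (ℕₚ.m+[n∸m]≡n (ℕₚ.<⇒≤ (s-inc M))) ⟨
        x ℕ.+ (s M ℕ.+ c)      ≡⟨ cong (x ℕ.+_) (ℕₚ.+-comm (s M) c) ⟩
        x ℕ.+ (c ℕ.+ s M)      ≡⟨ ℕₚ.+-assoc x c (s M) ⟨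
        x ℕ.+ c ℕ.+ s M        ∎)
        where open ≡-Reasoning
      B<x : B < x
      B<x = ℕₚ.+-cancelʳ-< (s (2 ℕ.+ M)) B x (begin-strict
        B ℕ.+ s (2 ℕ.+ M)      ≡⟨ ℕₚ.+-comm B (s (2 ℕ.+ M)) ⟩
        s (2 ℕ.+ M) ℕ.+ B      <⟨ ℕₚ.n<1+n _ ⟩
        t                      ≤⟨ strictly-increasing⇒n≤ s-inc t ⟩
        s t                    ≤⟨ ℕₚ.m≤n+m (s t) x₀ ⟩
        x₀ ℕ.+ s t             ≡⟨ ∂-sample-vary-last k s {1 ℕ.+ M} {t} {2 ℕ.+ M} ∂≡x ∂≡x₀ ⟨
        x ℕ.+ s (2 ℕ.+ M)      ∎)
        where open ℕₚ.≤-Reasoning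

E-notΔ : ∀ k → ¬ IsΔ k E
E-notΔ k Δ =
  let c , 1≤c , pairs = IsΔ⇒translate-pairs k Δ
      x , c²<x , x∈E , x+c∈E = pairs (c ℕ.* c)
  in ℕₚ.<⇒≱ c²<x (E-gap 1≤c x∈E x+c∈E)

lemma8p7 : Σ Subset λ E → IsSubsetOfPositives E × (∀ (k : ℕ) → IsΔ0 k E) × (∀ (k : ℕ) → ¬ IsΔ k E)
lemma8p7 = E , E-positive , E-isΔ0 , E-notΔ
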